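{- Let $\mathbb{C}_1,\dots,\mathbb{C}_n$ and $\mathbb{D}$ be comonads on categories $\mathcal{C}_1,\dots,\mathcal{C}_n$ and $\mathcal{D}$ respectively, and let $H\colon \mathcal{C}_1\times\dots\times\mathcal{C}_n \to \mathcal{D}$ be a functor. Suppose that for all objects $A_1\in\mathcal{C}_1,\dots,A_n\in\mathcal{C}_n$ there exists a morphism $$\kappa_{A_1,\dots,A_n}\colon \mathbb{D}(H(A_1,\dots,A_n)) \to H(\mathbb{C}_1(A_1),\dots,\mathbb{C}_n(A_n))$$ in $\mathcal{D}$ (no naturality or other condition is required). Then for all objects $A_i,B_i\in\mathcal{C}_i$ ($i=1,\dots,n$), $$A_1 \Rrightarrow_{\mathbb{C}_1} B_1,\ \dots,\ A_n \Rrightarrow_{\mathbb{C}_n} B_n \quad\text{implies}\quad H(A_1,\dots,A_n) \Rrightarrow_{\mathbb{D}} H(B_1,\dots,B_n).$$ The same holds with every $\Rrightarrow$ replaced by $\equiv^{+}$ (i.e. $A_i \equiv^+_{\mathbb{C}_i} B_i$ for all $i$ implies $H(A_1,\dots,A_n)\equiv^+_{\mathbb{D}} H(B_1,\dots,B_n)$).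
   Context: A comonad on a category $\mathcal{C}$ is a triple $(\mathbb{C},\varepsilon,\delta)$ where $\mathbb{C}\colon\mathcal{C}\to\mathcal{C}$ is a functor and $\varepsilon\colon\mathbb{C}\Rightarrow\mathrm{Id}$, $\delta\colon\mathbb{C}\Rightarrow\mathbb{C}^2$ are natural transformations with $\varepsilon_{\mathbb{C}A}\circ\delta_A=\mathrm{id}=\mathbb{C}(\varepsilon_A)\circ\delta_A$ and $\delta_{\mathbb{C}A}\circ\delta_A=\mathbb{C}(\delta_A)\circ\delta_A$. For a comonad $\mathbb{C}$ on $\mathcal{C}$ and objects $A,B$, write $A \Rrightarrow_{\mathbb{C}} B$ if there exists a morphism $\mathbb{C}(A)\to B$ in $\mathcal{C}$, and $A\equiv^{+}_{\mathbb{C}} B$ if both $A \Rrightarrow_{\mathbb{C}} B$ and $B \Rrightarrow_{\mathbb{C}} A$. -}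

module Defs where

open import Level using (Level; _⊔_; suc)
open import Data.Nat using (ℕ)
open import Data.Fin using (Fin)
open import Data.Product using (_×_; _,_)
open import Relation.Binary using (Rel; IsEquivalence)

record Category (o ℓ e : Level) : Set (suc (o ⊔ ℓ ⊔ e)) where
  infixr 9 _∘_
  infix  4 _≈_
  field
    Obj   : Set o
    Hom   : Obj → Obj → Set ℓ
    _≈_   : ∀ {A B} → Rel (Hom A B) e
    id    : ∀ {A} → Hom A A
    _∘_   : ∀ {A B C} → Hom B C → Hom A B → Hom A C
    equiv : ∀ {A B} → IsEquivalence (_≈_ {A} {B})
    ∘-resp-≈ : ∀ {A B C} {f h : Hom B C} {g i : Hom A B} →
               f ≈ h → g ≈ i → f ∘ g ≈ h ∘ i
    assoc    : ∀ {A B C D} {f : Hom A B} {g : Hom B C} {h : Hom C D} →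
               (h ∘ g) ∘ f ≈ h ∘ (g ∘ f)
    identityˡ : ∀ {A B} {f : Hom A B} → id ∘ f ≈ f
    identityʳ : ∀ {A B} {f : Hom A B} → f ∘ id ≈ f

open Category

record Functor {o ℓ e o′ ℓ′ e′ : Level}
       (C : Category o ℓ e) (D : Category o′ ℓ′ e′)
       : Set (o ⊔ ℓ ⊔ e ⊔ o′ ⊔ ℓ′ ⊔ e′) where
  field
    F₀ : Obj C → Obj D
    F₁ : ∀ {A B} → Hom C A B → Hom D (F₀ A) (F₀ B)
    identity     : ∀ {A} → _≈_ D (F₁ (id C {A})) (id D)
    homomorphism : ∀ {X Y Z} {f : Hom C X Y} {g : Hom C Y Z} →
                   _≈_ D (F₁ (_∘_ C g f)) (_∘_ D (F₁ g) (F₁ f))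
    F-resp-≈     : ∀ {A B} {f g : Hom C A B} → _≈_ C f g → _≈_ D (F₁ f) (F₁ g)

Product : ∀ {o ℓ e} (n : ℕ) → (Fin n → Category o ℓ e) → Category o ℓ e
Product n C = record
  { Obj = (i : Fin n) → Obj (C i)
  ; Hom = λ A B → (i : Fin n) → Hom (C i) (A i) (B i)
  ; _≈_ = λ f g → (i : Fin n) → _≈_ (C i) (f i) (g i)
  ; id  = λ i → id (C i)
  ; _∘_ = λ f g i → _∘_ (C i) (f i) (g i)
  ; equiv = record
    { refl  = λ i → IsEquivalence.refl (equiv (C i))
    ; sym   = λ p i → IsEquivalence.sym (equiv (C i)) (p i)
    ; trans = λ p q i → IsEquivalence.trans (equiv (C i)) (p i) (q i) }
  ; ∘-resp-≈  = λ p q i → ∘-resp-≈ (C i) (p i) (q i)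
  ; assoc     = λ i → assoc (C i)
  ; identityˡ = λ i → identityˡ (C i)
  ; identityʳ = λ i → identityʳ (C i)
  }

record Comonad {o ℓ e : Level} (C : Category o ℓ e) : Set (o ⊔ ℓ ⊔ e) where
  field
    F : Functor C C
  private
    module C = Category C
  open Functor F using (F₀; F₁)
  field
    ε : ∀ A → C.Hom (F₀ A) A
    δ : ∀ A → C.Hom (F₀ A) (F₀ (F₀ A))
    ε-natural : ∀ {A B} (f : C.Hom A B) → f C.∘ ε A C.≈ ε B C.∘ F₁ f
    δ-natural : ∀ {A B} (f : C.Hom A B) →
                F₁ (F₁ f) C.∘ δ A C.≈ δ B C.∘ F₁ f
    counitˡ : ∀ {A} → ε (F₀ A) C.∘ δ A C.≈ C.id
    counitʳ : ∀ {A} → F₁ (ε A) C.∘ δ A C.≈ C.id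
    coassoc : ∀ {A} → δ (F₀ A) C.∘ δ A C.≈ F₁ (δ A) C.∘ δ A

Ob : ∀ {o ℓ e} {C : Category o ℓ e} → Comonad C → Obj C → Obj C
Ob 𝕔 = Functor.F₀ (Comonad.F 𝕔)

_⇛⟨_⟩_ : ∀ {o ℓ e} {C : Category o ℓ e} → Obj C → Comonad C → Obj C → Set ℓ
_⇛⟨_⟩_ {C = C} A 𝕔 B = Hom C (Ob 𝕔 A) B

_≡⁺⟨_⟩_ : ∀ {o ℓ e} {C : Category o ℓ e} → Obj C → Comonad C → Obj C → Set ℓ
A ≡⁺⟨ 𝕔 ⟩ B = (A ⇛⟨ 𝕔 ⟩ B) × (B ⇛⟨ 𝕔 ⟩ A)

{-# OPTIONS --safe #-}
module Submission where

open import Defs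
open import Level using (Level)
open import Data.Nat using (ℕ)
open import Data.Fin using (Fin)
open import Data.Product using (_×_; _,_; proj₁; proj₂)

open Category using (Obj; Hom)
open Functor using (F₀; F₁)

-- G is an arbitrary object map on the source category; for a product category
-- it is the pointwise action of the factor comonads.
module _ {o ℓ e o′ ℓ′ e′ : Level} {E : Category o ℓ e} {D : Category o′ ℓ′ e′}
         (𝕕 : Comonad D) (H : Functor E D) (G : Obj E → Obj E)
         (κ : ∀ A → Hom D (Ob 𝕕 (F₀ H A)) (F₀ H (G A))) where

  lift-⇛ : ∀ {A B} → Hom E (G A) B → F₀ H A ⇛⟨ 𝕕 ⟩ F₀ H B
  lift-⇛ {A} f = Category._∘_ D (F₁ H f) (κ A)

  lift-≡⁺ : ∀ {A B} → Hom E (G A) B × Hom E (G B) A → F₀ H A ≡⁺⟨ 𝕕 ⟩ F₀ H B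
  lift-≡⁺ (f , g) = lift-⇛ f , lift-⇛ g

theorem3p2 : ∀ {o ℓ e o′ ℓ′ e′ : Level} (n : ℕ)
    (C : Fin n → Category o ℓ e) (𝕔 : (i : Fin n) → Comonad (C i))
    (D : Category o′ ℓ′ e′) (𝕕 : Comonad D)
    (H : Functor (Product n C) D) →
    (κ : (A : (i : Fin n) → Category.Obj (C i)) →
         Category.Hom D (Ob 𝕕 (Functor.F₀ H A)) (Functor.F₀ H (λ i → Ob (𝕔 i) (A i)))) →
    ((A B : (i : Fin n) → Category.Obj (C i)) →
       ((i : Fin n) → A i ⇛⟨ 𝕔 i ⟩ B i) →
       Functor.F₀ H A ⇛⟨ 𝕕 ⟩ Functor.F₀ H B)
    ×
    ((A B : (i : Fin n) → Category.Obj (C i)) →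
       ((i : Fin n) → A i ≡⁺⟨ 𝕔 i ⟩ B i) →
       Functor.F₀ H A ≡⁺⟨ 𝕕 ⟩ Functor.F₀ H B)
theorem3p2 n C 𝕔 D 𝕕 H κ =
    (λ _ _ → lift-⇛ 𝕕 H 𝕔× κ)
  , (λ _ _ p → lift-≡⁺ 𝕕 H 𝕔× κ ((λ i → proj₁ (p i)) , (λ i → proj₂ (p i))))
  where
  𝕔× : Obj (Product n C) → Obj (Product n C)
  𝕔× A i = Ob (𝕔 i) (A i)
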